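{- Every connected proof net is almost connected.
   Context: Unit-free multiplicative linear logic with mix. A proof structure is a directed acyclic partial graph (each edge has an optional source and an optional target) whose vertices are labeled ax, cut, ⊗ or ⅋: each ax-vertex has two conclusions and no premise, each cut-vertex has two premises and no conclusion, each ⊗-vertex and each ⅋-vertex has two premises and one conclusion; edges are labeled by formulas subject to the usual typing constraints. Paths are taken in the underlying undirected partial graph; a cycle is a non-empty simple closed path. A path is switching when it does not contain both premises of any ⅋-vertex; a proof net is a proof structure with no switching cycle. A path is cusp-free if it never passes through the two premises of a ⅋-vertex consecutively. A correctness graph is obtained by disconnecting one of the two premises of each ⅋-vertex; a proof net is connected if any (equivalently every) of its correctness graphs has exactly one connected component. A proper cycle of a ⅋-vertex v is a cycle of the form (v, e_1, u_1)·p·(u_2, e_2, v) where e_1, e_2 are the two premises of v and p is a cusp-free path. A proof net is almost connected if it is non-empty and every ⅋-vertex has a proper cycle. -}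

module Defs where

open import Data.Nat using (ℕ; suc; _≤_)
open import Data.Fin using (Fin)
open import Data.Maybe using (Maybe; just)
open import Data.List using (List; []; _∷_; length)
open import Data.List.Relation.Unary.Unique.Propositional using (Unique)
open import Data.List.Membership.Propositional using (_∈_)
open import Data.Product using (Σ; ∃; _×_; _,_; proj₁)
open import Data.Sum using (_⊎_; inj₁; inj₂)
open import Data.Unit using (⊤)
open import Data.Empty using (⊥)
open import Relation.Nullary using (¬_)
open import Relation.Binary.PropositionalEquality using (_≡_; _≢_)
open import Relation.Binary.Construct.Closure.ReflexiveTransitive using (Star)

-- Unit-free MLL formulas (atoms indexed by ℕ, negation pushed to atoms)

infixr 6 _⊗_ _⅋_
data Formula : Set where
  atom  : ℕ → Formula
  natom : ℕ → Formula
  _⊗_   : Formula → Formula → Formula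
  _⅋_   : Formula → Formula → Formula

dual : Formula → Formula
dual (atom x)  = natom x
dual (natom x) = atom x
dual (A ⊗ B)   = dual A ⅋ dual B
dual (A ⅋ B)   = dual A ⊗ dual B

data Label : Set where
  ax cut tens par : Label

record Graph : Set where
  field
    n       : ℕ
    m       : ℕ
    label   : Fin n → Label
    src     : Fin m → Maybe (Fin n)
    tgt     : Fin m → Maybe (Fin n)
    formula : Fin m → Formula

record TwoOf {m : ℕ} (P : Fin m → Set) : Set where
  field
    fst  : Fin m
    snd  : Fin m
    distinct : fst ≢ snd
    P-fst : P fst
    P-snd : P snd
    only  : ∀ g → P g → g ≡ fst ⊎ g ≡ snd

NoneOf : {m : ℕ} → (Fin m → Set) → Set
NoneOf P = ∀ g → ¬ P g

module _ (G : Graph) where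
  open Graph G

  Prem : Fin n → Fin m → Set
  Prem v e = tgt e ≡ just v

  Conc : Fin n → Fin m → Set
  Conc v e = src e ≡ just v

  LocalOK : Fin n → Label → Set
  LocalOK v ax   = Σ (TwoOf (Conc v)) λ c →
    NoneOf (Prem v) × (formula (TwoOf.snd c) ≡ dual (formula (TwoOf.fst c)))
  LocalOK v cut  = Σ (TwoOf (Prem v)) λ p →
    NoneOf (Conc v) × (formula (TwoOf.snd p) ≡ dual (formula (TwoOf.fst p)))
  LocalOK v tens = Σ (TwoOf (Prem v)) λ p → Σ (Fin m) λ c →
    Conc v c × (∀ g → Conc v g → g ≡ c) ×
    (formula c ≡ formula (TwoOf.fst p) ⊗ formula (TwoOf.snd p))
  LocalOK v par  = Σ (TwoOf (Prem v)) λ p → Σ (Fin m) λ c →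
    Conc v c × (∀ g → Conc v g → g ≡ c) ×
    (formula c ≡ formula (TwoOf.fst p) ⅋ formula (TwoOf.snd p))

  Link : Fin m → Fin n → Fin n → Set
  Link e u w = (src e ≡ just u × tgt e ≡ just w) ⊎ (src e ≡ just w × tgt e ≡ just u)

  data Path : Fin n → Fin n → Set where
    []   : ∀ {u} → Path u u
    step : ∀ {u w x} (e : Fin m) → Link e u w → Path w x → Path u x

  _++ₚ_ : ∀ {u w x} → Path u w → Path w x → Path u x
  [] ++ₚ q = q
  step e l p ++ₚ q = step e l (p ++ₚ q)

  edges : ∀ {u w} → Path u w → List (Fin m)
  edges [] = []
  edges (step e _ p) = e ∷ edges p

  starts : ∀ {u w} → Path u w → List (Fin n)
  starts [] = []
  starts (step {u} _ _ p) = u ∷ starts p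

  -- a cycle: a non-empty simple closed path
  -- (pairwise distinct edges, pairwise distinct vertices apart from
  -- the identification of the first and last vertex)
  IsCycle : ∀ {v} → Path v v → Set
  IsCycle p = (1 ≤ length (edges p)) × Unique (edges p) × Unique (starts p)

  Directed : ∀ {u w} → Path u w → Set
  Directed [] = ⊤
  Directed (step {u} {w} e _ p) = (src e ≡ just u × tgt e ≡ just w) × Directed p

  Acyclic : Set
  Acyclic = ∀ v (p : Path v v) → IsCycle p → ¬ Directed p

  IsProofStructure : Set
  IsProofStructure = (∀ v → LocalOK v (label v)) × Acyclic

  Switching : ∀ {u w} → Path u w → Set
  Switching p = ∀ v e f → label v ≡ par → Prem v e → Prem v f → e ≢ f →
    e ∈ edges p → f ∈ edges p → ⊥

  IsProofNet : Set
  IsProofNet = IsProofStructure ×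
    (∀ v (p : Path v v) → IsCycle p → ¬ Switching p)

  CuspAt : Fin n → Fin m → Fin m → Set
  CuspAt w e f = label w ≡ par × Prem w e × Prem w f × e ≢ f

  CuspFree : ∀ {u w} → Path u w → Set
  CuspFree [] = ⊤
  CuspFree (step e _ []) = ⊤
  CuspFree (step {w = w} e _ (step f l q)) = ¬ CuspAt w e f × CuspFree (step f l q)

  -- a choice, for every ⅋-vertex, of one of its premises to disconnect
  SwitchingFn : Set
  SwitchingFn = ∀ v → label v ≡ par → Σ (Fin m) (Prem v)

  Node : Set
  Node = Fin n ⊎ Fin m

  Attached : SwitchingFn → Fin n → Fin m → Set
  Attached s v e = src e ≡ just v ⊎
    (tgt e ≡ just v × ¬ (Σ (label v ≡ par) λ pv → proj₁ (s v pv) ≡ e))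

  data Adj (s : SwitchingFn) : Node → Node → Set where
    v→e : ∀ {v e} → Attached s v e → Adj s (inj₁ v) (inj₂ e)
    e→v : ∀ {v e} → Attached s v e → Adj s (inj₂ e) (inj₁ v)

  OneComponent : SwitchingFn → Set
  OneComponent s = Node × (∀ x y → Star (Adj s) x y)

  -- connected proof net: some (equivalently every) correctness graph
  -- has exactly one connected component
  IsConnected : Set
  IsConnected = Σ SwitchingFn OneComponent

  ProperCycle : Fin n → Set
  ProperCycle v = Σ (Fin m) λ e₁ → Σ (Fin m) λ e₂ → Σ (Fin n) λ u₁ → Σ (Fin n) λ u₂ →
    Σ (Link e₁ v u₁) λ l₁ → Σ (Link e₂ u₂ v) λ l₂ → Σ (Path u₁ u₂) λ p →
    Prem v e₁ × Prem v e₂ × e₁ ≢ e₂ × CuspFree p ×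
    IsCycle (step e₁ l₁ (p ++ₚ step e₂ l₂ []))

  IsAlmostConnected : Set
  IsAlmostConnected = Node × (∀ v → label v ≡ par → ProperCycle v)

-- Fix a switching s whose correctness graph is connected, and a ⅋-vertex v
-- with s disconnecting its premise d. In the correctness graph v still
-- reaches d, hence (shortcutting the walk) there is a simple path Q from v
-- to the source of d along edges that s does not disconnect; closing Q
-- with d gives a cycle. No ⅋-vertex has both premises on Q, so Q is
-- cusp-free. If Q is empty, d is a loop, contradicting acyclicity; if Q
-- leaves v by its conclusion, the cycle is switching; so Q enters v by
-- its other premise, and the cycle is a proper cycle of v.
module Submission where

open import Defs
open import Data.Nat using (_≤_; s≤s; z≤n)
open import Data.Fin using (Fin)
open import Data.Fin.Properties using (_≟_)
open import Data.Maybe using (just)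
open import Data.Maybe.Properties using (just-injective)
open import Data.List using (List; []; _∷_; _++_; length)
open import Data.List.Properties using (length-++-sucʳ)
open import Data.List.Relation.Unary.All using (All; []; _∷_; lookup)
open import Data.List.Relation.Unary.All.Properties using (¬Any⇒All¬; All¬⇒¬Any)
open import Data.List.Relation.Unary.Any using (here; there; any?)
open import Data.List.Relation.Unary.AllPairs using ([]; _∷_)
open import Data.List.Relation.Unary.Unique.Propositional using (Unique)
import Data.List.Relation.Unary.Unique.Propositional.Properties as Unique
open import Data.List.Membership.Propositional using (_∈_; _∉_)
open import Data.List.Membership.Propositional.Properties using (∈-++⁻)
open import Data.Product using (Σ; _×_; _,_; proj₁; proj₂)
open import Data.Sum using (_⊎_; inj₁; inj₂)
open import Data.Unit using (tt)
open import Data.Empty using (⊥; ⊥-elim)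
open import Relation.Nullary using (¬_; yes; no)
open import Relation.Binary.PropositionalEquality
  using (_≡_; _≢_; refl; sym; trans; cong; subst)
open import Relation.Binary.Construct.Closure.ReflexiveTransitive using (Star; ε; _◅_)

TwoOf-either : ∀ {m} {P : Fin m → Set} → TwoOf P →
  ∀ {h e f} → P h → P e → P f → e ≢ f → h ≡ e ⊎ h ≡ f
TwoOf-either t ph pe pf e≢f
  with TwoOf.only t _ ph | TwoOf.only t _ pe | TwoOf.only t _ pf
... | inj₁ a | inj₁ b | _      = inj₁ (trans a (sym b))
... | inj₂ a | inj₂ b | _      = inj₁ (trans a (sym b))
... | inj₁ a | _      | inj₁ c = inj₂ (trans a (sym c))
... | inj₂ a | _      | inj₂ c = inj₂ (trans a (sym c))
... | inj₁ _ | inj₂ b | inj₂ c = ⊥-elim (e≢f (trans b (sym c)))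
... | inj₂ _ | inj₁ b | inj₁ c = ⊥-elim (e≢f (trans b (sym c)))

Unique-∷ʳ : ∀ {A : Set} {x : A} xs → Unique xs → x ∉ xs → Unique (xs ++ x ∷ [])
Unique-∷ʳ xs xs! x∉xs = Unique.++⁺ xs! ([] ∷ []) λ { (i , here refl) → x∉xs i }

1≤length-∷ʳ : ∀ {A : Set} (x : A) xs → 1 ≤ length (xs ++ x ∷ [])
1≤length-∷ʳ x xs = subst (1 ≤_) (sym (length-++-sucʳ xs x [])) (s≤s z≤n)

module _ (G : Graph) where
  open Graph G

  vertices : ∀ {u w} → Path G u w → List (Fin n)
  vertices {w = w} p = starts G p ++ w ∷ []

  start∈vertices : ∀ {u w} (p : Path G u w) → u ∈ vertices p
  start∈vertices []           = here refl
  start∈vertices (step _ _ _) = here refl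

  edges-++ₚ : ∀ {u w x} (p : Path G u w) (q : Path G w x) →
    edges G (_++ₚ_ G p q) ≡ edges G p ++ edges G q
  edges-++ₚ []           q = refl
  edges-++ₚ (step e l p) q = cong (e ∷_) (edges-++ₚ p q)

  starts-++ₚ : ∀ {u w x} (p : Path G u w) (q : Path G w x) →
    starts G (_++ₚ_ G p q) ≡ starts G p ++ starts G q
  starts-++ₚ []           q = refl
  starts-++ₚ (step _ _ p) q = cong (_ ∷_) (starts-++ₚ p q)

  Incident : Fin m → Fin n → Set
  Incident e y = src e ≡ just y ⊎ tgt e ≡ just y

  Link-incident : ∀ {e a b y} → Link G e a b → Incident e y → y ≡ a ⊎ y ≡ b
  Link-incident (inj₁ (sa , _)) (inj₁ sy) = inj₁ (just-injective (trans (sym sy) sa))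
  Link-incident (inj₁ (_ , tb)) (inj₂ ty) = inj₂ (just-injective (trans (sym ty) tb))
  Link-incident (inj₂ (sb , _)) (inj₁ sy) = inj₂ (just-injective (trans (sym sy) sb))
  Link-incident (inj₂ (_ , ta)) (inj₂ ty) = inj₁ (just-injective (trans (sym ty) ta))

  Link-incidentˡ : ∀ {e a b} → Link G e a b → Incident e a
  Link-incidentˡ (inj₁ (sa , _)) = inj₁ sa
  Link-incidentˡ (inj₂ (_ , ta)) = inj₂ ta

  incident∈vertices : ∀ {u w e y} (p : Path G u w) → e ∈ edges G p →
    Incident e y → y ∈ vertices p
  incident∈vertices (step e l p) (here refl) e~y with Link-incident l e~y
  ... | inj₁ refl = here refl
  ... | inj₂ refl = there (start∈vertices p)
  incident∈vertices (step e l p) (there i) e~y = there (incident∈vertices p i e~y)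

  Unique-edges : ∀ {u w} (p : Path G u w) → Unique (vertices p) → Unique (edges G p)
  Unique-edges []           _            = []
  Unique-edges (step e l p) (u∉p ∷ p!) =
    ¬Any⇒All¬ _ (λ e∈p → All¬⇒¬Any u∉p (incident∈vertices p e∈p (Link-incidentˡ l)))
    ∷ Unique-edges p p!

  closing-isCycle : ∀ {u w e} (p : Path G u w) (l : Link G e w u) →
    Unique (vertices p) → e ∉ edges G p → IsCycle G (_++ₚ_ G p (step e l []))
  closing-isCycle p l p! e∉p
    rewrite edges-++ₚ p (step _ l []) | starts-++ₚ p (step _ l []) =
    1≤length-∷ʳ _ (edges G p) , Unique-∷ʳ (edges G p) (Unique-edges p p!) e∉p , p!

  ¬premise-of-start : ∀ {u x y g f} {sg : src g ≡ just u} {tg : tgt g ≡ just x}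
    (q : Path G x y) → Unique (vertices (step g (inj₁ (sg , tg)) q)) →
    f ∈ edges G (step g (inj₁ (sg , tg)) q) → ¬ Prem G u f
  ¬premise-of-start {tg = tg} q (u∉q ∷ _) (here refl) tf
    with just-injective (trans (sym tg) tf)
  ... | refl = All¬⇒¬Any u∉q (start∈vertices q)
  ¬premise-of-start q (u∉q ∷ _) (there i) tf =
    All¬⇒¬Any u∉q (incident∈vertices q i (inj₂ tf))

  record SimplePath (P : Fin m → Set) (u w : Fin n) : Set where
    field
      path   : Path G u w
      simple : Unique (vertices path)
      along  : All P (edges G path)

  open SimplePath

  suffixFrom : ∀ {P u w x} (p : SimplePath P w x) → u ∈ vertices (path p) → SimplePath P u x
  suffixFrom record { path = [] ; simple = p! ; along = ps } (here refl) =
    record { path = [] ; simple = p! ; along = ps }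
  suffixFrom p@record { path = step _ _ _ } (here refl) = p
  suffixFrom record { path = step _ _ q ; simple = _ ∷ q! ; along = _ ∷ qs } (there i) =
    suffixFrom record { path = q ; simple = q! ; along = qs } i

module _ (G : Graph) (s : SwitchingFn G) where
  open Graph G
  open SimplePath

  Kept : Fin m → Set
  Kept e = ∀ w (pw : label w ≡ par) → proj₁ (s w pw) ≢ e

  attached-disconnected⇒source : ∀ {x z e} → Attached G s x e →
    (pz : label z ≡ par) → proj₁ (s z pz) ≡ e → src e ≡ just x
  attached-disconnected⇒source (inj₁ sx) _ _ = sx
  attached-disconnected⇒source {z = z} (inj₂ (tx , ¬disc)) pz refl
    with just-injective (trans (sym tx) (proj₂ (s z pz)))
  ... | refl = ⊥-elim (¬disc (pz , refl))

  attached-both⇒kept : ∀ {u w e} → Attached G s u e → Attached G s w e → u ≢ w → Kept e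
  attached-both⇒kept au aw u≢w z pz disc = u≢w (just-injective (trans
    (sym (attached-disconnected⇒source au pz disc))
    (attached-disconnected⇒source aw pz disc)))

  attached-both⇒link : ∀ {u w e} → Attached G s u e → Attached G s w e → u ≢ w → Link G e u w
  attached-both⇒link (inj₁ su)       (inj₁ sw)       u≢w = ⊥-elim (u≢w (just-injective (trans (sym su) sw)))
  attached-both⇒link (inj₁ su)       (inj₂ (tw , _)) _   = inj₁ (su , tw)
  attached-both⇒link (inj₂ (tu , _)) (inj₁ sw)       _   = inj₂ (sw , tu)
  attached-both⇒link (inj₂ (tu , _)) (inj₂ (tw , _)) u≢w = ⊥-elim (u≢w (just-injective (trans (sym tu) tw)))

  shortcut : ∀ {u w x e} → Attached G s u e → Attached G s w e →
    SimplePath G Kept w x → SimplePath G Kept u x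
  shortcut {u} au aw p with any? (u ≟_) (vertices G (path p))
  ... | yes u∈p = suffixFrom G p u∈p
  ... | no  u∉p = record
    { path   = step _ (attached-both⇒link au aw u≢w) (path p)
    ; simple = ¬Any⇒All¬ _ u∉p ∷ simple p
    ; along  = attached-both⇒kept au aw u≢w ∷ along p
    }
    where
    u≢w : _ ≢ _
    u≢w refl = u∉p (start∈vertices G (path p))

  reach⇒simplePath : ∀ {u e} → Star (Adj G s) (inj₁ u) (inj₂ e) →
    Σ (Fin n) λ w → Attached G s w e × SimplePath G Kept u w
  reach⇒simplePath (v→e au ◅ ε) =
    _ , au , record { path = [] ; simple = [] ∷ [] ; along = [] }
  reach⇒simplePath (v→e au ◅ e→v aw ◅ rest) with reach⇒simplePath rest
  ... | x , ae , p = x , ae , shortcut au aw p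

  module _ (ok : ∀ v → LocalOK G v (label v)) where

    premises : ∀ {w} → label w ≡ par → TwoOf (Prem G w)
    premises {w} pw = proj₁ (subst (LocalOK G w) pw (ok w))

    ¬both-premises-kept : ∀ {w e f} → label w ≡ par → Prem G w e → Prem G w f → e ≢ f →
      Kept e → Kept f → ⊥
    ¬both-premises-kept {w} pw pe pf e≢f ke kf
      with TwoOf-either (premises pw) (proj₂ (s w pw)) pe pf e≢f
    ... | inj₁ disc = ke w pw disc
    ... | inj₂ disc = kf w pw disc

    kept⇒cuspFree : ∀ {u w} (p : Path G u w) → All Kept (edges G p) → CuspFree G p
    kept⇒cuspFree []                     _ = tt
    kept⇒cuspFree (step _ _ [])          _ = tt
    kept⇒cuspFree (step e _ (step f l q)) (ke ∷ kf ∷ ks) =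
      (λ (pw , pe , pf , e≢f) → ¬both-premises-kept pw pe pf e≢f ke kf)
      , kept⇒cuspFree (step f l q) (kf ∷ ks)

    module _ {v} (pv : label v ≡ par) where

      d : Fin m
      d = proj₁ (s v pv)

      d-premise : Prem G v d
      d-premise = proj₂ (s v pv)

      d∉kept : ∀ {u w} (p : Path G u w) → All Kept (edges G p) → d ∉ edges G p
      d∉kept p ks i = lookup ks i v pv refl

      d-link : ∀ {w} → src d ≡ just w → Link G d w v
      d-link sd = inj₁ (sd , d-premise)

      closing : ∀ {w} → src d ≡ just w → Path G v w → Path G v v
      closing sd q = _++ₚ_ G q (step d (d-link sd) [])

      closing-switching : ∀ {w x g} {sg : src g ≡ just v} {tg : tgt g ≡ just x}
        (sd : src d ≡ just w) (q : Path G x w) →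
        let Q = step g (inj₁ (sg , tg)) q in
        Unique (vertices G Q) → All Kept (edges G Q) → Switching G (closing sd Q)
      closing-switching {g = g} {sg} {tg} sd q Q! ks w e f pw pe pf e≢f e∈C f∈C
        with on-Q-or-d e∈C | on-Q-or-d f∈C
        where
        Q = step g (inj₁ (sg , tg)) q
        on-Q-or-d : ∀ {e} → e ∈ edges G (closing sd Q) → e ∈ edges G Q ⊎ e ≡ d
        on-Q-or-d {e} i with ∈-++⁻ (edges G Q) (subst (e ∈_) (edges-++ₚ G Q _) i)
        ... | inj₁ j         = inj₁ j
        ... | inj₂ (here eq) = inj₂ eq
      ... | inj₁ i    | inj₁ j    = ¬both-premises-kept pw pe pf e≢f (lookup ks i) (lookup ks j)
      ... | inj₂ refl | inj₂ refl = e≢f refl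
      ... | inj₂ refl | inj₁ j    = ¬premise-of-start G {sg = sg} {tg} q Q! j (trans pf (trans (sym pe) d-premise))
      ... | inj₁ i    | inj₂ refl = ¬premise-of-start G {sg = sg} {tg} q Q! i (trans pe (trans (sym pf) d-premise))

      closing-properCycle : ∀ {w} → Acyclic G →
        (∀ u (c : Path G u u) → IsCycle G c → ¬ Switching G c) →
        (sd : src d ≡ just w) → SimplePath G Kept v w → ProperCycle G v
      closing-properCycle acyc _ sd record { path = [] } =
        ⊥-elim (acyc v (closing sd []) (closing-isCycle G [] (d-link sd) ([] ∷ []) λ ()) ((sd , d-premise) , tt))
      closing-properCycle _ _ sd record { path = Q@(step g (inj₂ (sg , tg)) q) ; simple = Q! ; along = ks@(kg ∷ kq) } =
        g , d , _ , _ , inj₂ (sg , tg) , d-link sd , q , tg , d-premise ,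
        (λ g≡d → kg v pv (sym g≡d)) , kept⇒cuspFree q kq ,
        closing-isCycle G Q (d-link sd) Q! (d∉kept Q ks)
      closing-properCycle _ noSwitching sd record { path = Q@(step g (inj₁ (sg , tg)) q) ; simple = Q! ; along = ks } =
        ⊥-elim (noSwitching v (closing sd Q)
          (closing-isCycle G Q (d-link sd) Q! (d∉kept Q ks)) (closing-switching {sg = sg} {tg} sd q Q! ks))

      reach-disconnected-premise : (∀ x y → Star (Adj G s) x y) →
        Σ (Fin n) λ w → src d ≡ just w × SimplePath G Kept v w
      reach-disconnected-premise conn with reach⇒simplePath (conn (inj₁ v) (inj₂ d))
      ... | w , aw , p = w , attached-disconnected⇒source aw pv refl , p

lemma7p6 : (G : Graph) → IsProofNet G → IsConnected G → IsAlmostConnected G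
lemma7p6 G ((ok , acyclic) , noSwitchingCycle) (s , node , conn) = node , properCycle
  where
  properCycle : ∀ v → Graph.label G v ≡ par → ProperCycle G v
  properCycle v pv with reach-disconnected-premise G s ok pv conn
  ... | w , sd , p = closing-properCycle G s ok pv acyclic noSwitchingCycle sd p
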